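{- Let $G$ be a simple, $3$-edge-connected graph with $\operatorname{gon}(G)=3$, and let $D$ be a divisor on $G$ with $r(D)=1$ and $\deg(D)=3$. For each vertex $v$, let $D_v$ be the unique effective divisor with $D_v\sim D$ and $v\in\mathrm{supp}(D_v)$ (such a divisor exists and is unique under these hypotheses), and let $[v]_D=\mathrm{supp}(D_v)$. If $uv\in E(G)$ is an edge with $[u]_D\neq[v]_D$, then there are exactly three edges joining a vertex of $[u]_D$ to a vertex of $[v]_D$, and for every vertex $u'\in[u]_D$ the number of edges joining $u'$ to vertices of $[v]_D$ equals $D_{u'}(u')$.
   Context: A graph is finite, connected, loopless; simple means no multiple edges. $3$-edge-connected means deleting any $2$ edges leaves the graph connected. A divisor is an integer combination $\sum_v D(v)(v)$ of vertices; it is effective if all coefficients are $\ge0$, and $\mathrm{supp}(D)=\{v:D(v)>0\}$. $D\sim D'$ if $D-D'$ is in the image of the Laplacian ($\Delta_{v,v}=\mathrm{val}(v)$, $\Delta_{v,w}=-$number of edges between $v,w$). The rank $r(D)$ is $-1$ if no effective divisor is equivalent to $D$, and otherwise the largest $k$ such that for every effective divisor $F$ of degree $k$ some effective divisor is equivalent to $D-F$. $\operatorname{gon}(G)$ is the minimum degree of an effective divisor of rank $\ge1$. The sets $[v]_D$ partition $V(G)$ (the classes of the relation $v_1\sim_D v_2$ iff $v_1\in\mathrm{supp}(D_{v_2})$ and $v_2\in\mathrm{supp}(D_{v_1})$). -}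

module Defs where

open import Data.Nat as ℕ using (ℕ; zero; suc)
open import Data.Integer as ℤ using (ℤ; +_; +[1+_]; -[1+_])
open import Data.Fin using (Fin; zero; suc)
open import Data.Bool using (Bool; true; false; if_then_else_; _∧_)
open import Data.Product using (Σ; ∃; ∃-syntax; _×_; _,_)
open import Data.Sum using (_⊎_)
open import Relation.Binary.PropositionalEquality using (_≡_)
open import Relation.Nullary using (¬_)

∑ℕ : ∀ {m} → (Fin m → ℕ) → ℕ
∑ℕ {zero}  f = 0
∑ℕ {suc m} f = f zero ℕ.+ ∑ℕ (λ i → f (suc i))

∑ℤ : ∀ {m} → (Fin m → ℤ) → ℤ
∑ℤ {zero}  f = + 0
∑ℤ {suc m} f = f zero ℤ.+ ∑ℤ (λ i → f (suc i))

record Graph : Set where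
  field
    n        : ℕ
    adj      : Fin n → Fin n → ℕ          -- number of edges between u and v
    adj-sym  : ∀ u v → adj u v ≡ adj v u
    loopless : ∀ v → adj v v ≡ 0

Vertex : Graph → Set
Vertex G = Fin (Graph.n G)

data Reach {m : ℕ} (a : Fin m → Fin m → ℕ) : Fin m → Fin m → Set where
  here : ∀ {v} → Reach a v v
  step : ∀ {u w v} → 1 ℕ.≤ a u w → Reach a w v → Reach a u v

ConnectedAdj : ∀ {m} → (Fin m → Fin m → ℕ) → Set
ConnectedAdj {m} a = ∀ (u v : Fin m) → Reach a u v

Connected : Graph → Set
Connected G = ConnectedAdj (Graph.adj G)

Simple : Graph → Set
Simple G = ∀ u v → Graph.adj G u v ℕ.≤ 1

-- A choice of exactly two edges of G (as a sub-multiset `del` of the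
-- edge multiset: symmetric, loopless, del ≤ adj, and counting every
-- edge twice in the double sum, total 4 = 2 edges).
TwoEdges : (G : Graph) → (Vertex G → Vertex G → ℕ) → Set
TwoEdges G del =
    (∀ u v → del u v ≡ del v u)
  × (∀ v → del v v ≡ 0)
  × (∀ u v → del u v ℕ.≤ Graph.adj G u v)
  × (∑ℕ (λ u → ∑ℕ (λ v → del u v)) ≡ 4)

ThreeEdgeConnected : Graph → Set
ThreeEdgeConnected G =
  ∀ (del : Vertex G → Vertex G → ℕ) → TwoEdges G del →
    ConnectedAdj (λ u v → Graph.adj G u v ℕ.∸ del u v)

Divisor : Graph → Set
Divisor G = Vertex G → ℤ

deg : (G : Graph) → Divisor G → ℤ
deg G D = ∑ℤ D

Effective : (G : Graph) → Divisor G → Set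
Effective G D = ∀ v → + 0 ℤ.≤ D v

_-ᴰ_ : ∀ {G : Graph} → Divisor G → Divisor G → Divisor G
(D -ᴰ E) v = D v ℤ.- E v

val : (G : Graph) → Vertex G → ℕ
val G v = ∑ℕ (λ w → Graph.adj G v w)

Laplacian : (G : Graph) → (Vertex G → ℤ) → Divisor G
Laplacian G f v = (+ val G v) ℤ.* f v ℤ.- ∑ℤ (λ w → (+ Graph.adj G v w) ℤ.* f w)

Equiv : (G : Graph) → Divisor G → Divisor G → Set
Equiv G D D' = ∃[ f ] (∀ v → D v ℤ.- D' v ≡ Laplacian G f v)

RankCond : (G : Graph) → Divisor G → ℕ → Set
RankCond G D k =
  ∀ (F : Divisor G) → Effective G F → deg G F ≡ + k →
    ∃[ E ] (Effective G E × Equiv G E (_-ᴰ_ {G} D F))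

HasRank : (G : Graph) → Divisor G → ℤ → Set
HasRank G D r =
    (r ≡ -[1+ 0 ] × ¬ (∃[ E ] (Effective G E × Equiv G E D)))
  ⊎ (∃[ k ] (r ≡ + k × RankCond G D k × (∀ m → k ℕ.< m → ¬ RankCond G D m)))

RankAtLeast : (G : Graph) → Divisor G → ℤ → Set
RankAtLeast G D s = ∃[ r ] (HasRank G D r × s ℤ.≤ r)

Gonality : (G : Graph) → ℕ → Set
Gonality G g =
    (∃[ D ] (Effective G D × RankAtLeast G D (+ 1) × deg G D ≡ + g))
  × (∀ (D : Divisor G) → Effective G D → RankAtLeast G D (+ 1) → + g ℤ.≤ deg G D)

pos : ℤ → Bool
pos +[1+ _ ] = true
pos _        = false

InSupp : (G : Graph) → Vertex G → Divisor G → Set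
InSupp G v D = + 0 ℤ.< D v

SameSupp : (G : Graph) → Divisor G → Divisor G → Set
SameSupp G D E = ∀ v → (InSupp G v D → InSupp G v E) × (InSupp G v E → InSupp G v D)

edgesBetween : (G : Graph) → Divisor G → Divisor G → ℕ
edgesBetween G A B =
  ∑ℕ (λ a → ∑ℕ (λ b → if pos (A a) ∧ pos (B b) then Graph.adj G a b else 0))

edgesTo : (G : Graph) → Vertex G → Divisor G → ℕ
edgesTo G a B = ∑ℕ (λ b → if pos (B b) then Graph.adj G a b else 0)

module Submission where

-- Write Dv = Du − Δh for a potential h and let T be the level set where h is maximal.
-- Summing over T gives  Σ_T Dv = Σ_T Du − (edges leaving T) − (excess drops of h),  where every term
-- is nonnegative.  Since Σ_T Du ≤ deg Du = 3 and every cut separating two vertices has at least 3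
-- edges, all terms are extremal: supp Du ⊆ T, Dv vanishes on T, h drops by exactly one across the cut
-- and Du(x) counts the edges leaving T at x.  The same applied to −h places supp Dv on the bottom
-- level, which contains the outer end of every edge leaving T; counting edges gives both claims, and
-- the uniqueness of D_{u'} follows from the same lemma.

open import Defs
open import Data.Nat as ℕ using (ℕ; zero; suc)
import Data.Integer as ℤ
open import Data.Integer using (ℤ; +_; +[1+_]; _+_; _-_; -_; _*_; _≤_; _<_; +≤+; +<+)
import Data.Integer.Properties as ℤP
open import Data.Fin using (Fin; zero; suc; punchIn)
open import Data.Fin.Properties using (punchInᵢ≢i; any?; all?; ¬∀⟶∃¬) renaming (_≟_ to _≟ᶠ_)
open import Data.List using (allFin)
import Data.List.Relation.Unary.All as All
open import Data.List.Membership.Propositional.Properties using (∈-allFin)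
open import Data.List.Extrema ℤP.≤-totalOrder using (argmax; f[xs]≤f[argmax])
open import Data.Bool using (Bool; true; false; if_then_else_; not; _xor_; _∧_; _∨_)
open import Data.Bool.Properties using (xor-same; ∧-comm; ∨-comm) renaming (_≟_ to _≟ᵇ_)
import Data.Nat.Properties as ℕP
open import Data.Empty using (⊥; ⊥-elim)
open import Data.Sum using (_⊎_; inj₁; inj₂; [_,_]; swap)
open import Relation.Binary.PropositionalEquality
  using (_≡_; _≢_; refl; sym; trans; cong; cong₂; subst; module ≡-Reasoning)
open import Relation.Nullary using (¬_; Dec; does; yes; no)
open import Function using (_∘_)
open import Data.Product using (∃-syntax; _,_; _×_; proj₁; proj₂)
open import Data.Integer.Tactic.RingSolver using (solve-∀)
open import Relation.Nullary.Decidable using (dec-true; dec-false; _×-dec_)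
open import Algebra.Properties.Semiring.Sum ℤP.+-*-semiring
  using (sum; sum-cong-≗; sum-replicate-zero; sum-remove; ∑-distrib-+; ∑-comm; *-distribʳ-sum)

∑ℤ≡sum : ∀ {m} (f : Fin m → ℤ) → ∑ℤ f ≡ sum f
∑ℤ≡sum {zero}  f = refl
∑ℤ≡sum {suc m} f = cong (_+_ (f zero)) (∑ℤ≡sum (λ i → f (suc i)))

∑ℕ≡sum : ∀ {m} (f : Fin m → ℕ) → + ∑ℕ f ≡ sum (λ i → + f i)
∑ℕ≡sum {zero}  f = refl
∑ℕ≡sum {suc m} f =
  trans (ℤP.pos-+ (f zero) _) (cong (_+_ (+ f zero)) (∑ℕ≡sum (λ i → f (suc i))))

sum-zero : ∀ {m} {f : Fin m → ℤ} → (∀ i → f i ≡ + 0) → sum f ≡ + 0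
sum-zero {m} f≡0 = trans (sum-cong-≗ f≡0) (sum-replicate-zero m)

sum-neg : ∀ {m} (f : Fin m → ℤ) → sum (λ i → - f i) ≡ - sum f
sum-neg {zero}  f = refl
sum-neg {suc m} f =
  trans (cong (_+_ (- f zero)) (sum-neg (λ i → f (suc i)))) (sym (ℤP.neg-distrib-+ (f zero) _))

sum-nonneg : ∀ {m} {f : Fin m → ℤ} → (∀ i → + 0 ≤ f i) → + 0 ≤ sum f
sum-nonneg {zero}  f≥0 = ℤP.≤-refl
sum-nonneg {suc m} f≥0 = ℤP.+-mono-≤ (f≥0 zero) (sum-nonneg (λ i → f≥0 (suc i)))

_on_ : ∀ {m} → (Fin m → ℤ) → (Fin m → Bool) → Fin m → ℤ
(h on S) x = if S x then h x else + 0

_off_ : ∀ {m} → (Fin m → ℤ) → (Fin m → Bool) → Fin m → ℤ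
(h off S) x = if S x then + 0 else h x

sum-on-off : ∀ {m} (h : Fin m → ℤ) (S : Fin m → Bool) → sum h ≡ sum (h on S) + sum (h off S)
sum-on-off h S = trans (sum-cong-≗ split) (∑-distrib-+ (h on S) (h off S))
  where
  split : ∀ x → h x ≡ (h on S) x + (h off S) x
  split x with S x
  ... | true  = sym (ℤP.+-identityʳ (h x))
  ... | false = sym (ℤP.+-identityˡ (h x))

on-nonneg : ∀ {m} {h : Fin m → ℤ} (S : Fin m → Bool) → (∀ x → + 0 ≤ h x) → ∀ x → + 0 ≤ (h on S) x
on-nonneg S h≥0 x with S x
... | true  = h≥0 x
... | false = ℤP.≤-refl

off-nonneg : ∀ {m} {h : Fin m → ℤ} (S : Fin m → Bool) → (∀ x → + 0 ≤ h x) → ∀ x → + 0 ≤ (h off S) x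
off-nonneg S h≥0 x with S x
... | true  = ℤP.≤-refl
... | false = h≥0 x

on-inside : ∀ {m} (h : Fin m → ℤ) (S : Fin m → Bool) {x} → S x ≡ true → (h on S) x ≡ h x
on-inside h S {x} Sx = cong (λ b → if b then h x else + 0) Sx

on-outside : ∀ {m} (h : Fin m → ℤ) (S : Fin m → Bool) {x} → S x ≡ false → (h on S) x ≡ + 0
on-outside h S {x} ¬Sx = cong (λ b → if b then h x else + 0) ¬Sx

off-outside : ∀ {m} (h : Fin m → ℤ) (S : Fin m → Bool) {x} → S x ≡ false → (h off S) x ≡ h x
off-outside h S {x} ¬Sx = cong (λ b → if b then + 0 else h x) ¬Sx

at : ∀ {m} → Fin m → Fin m → Bool
at a x = does (x ≟ᶠ a)

off-at : ∀ {m} (f : Fin m → ℤ) {a x : Fin m} → x ≢ a → (f off at a) x ≡ f x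
off-at f {a} {x} x≢a = off-outside f (at a) (dec-false (x ≟ᶠ a) x≢a)

sum-extract : ∀ {m} (f : Fin m → ℤ) (a : Fin m) → sum f ≡ f a + sum (f off at a)
sum-extract {suc m} f a =
  trans (sum-remove {i = a} f) (cong (_+_ (f a)) (sym rest))
  where
  rest : sum (f off at a) ≡ sum (λ j → f (punchIn a j))
  rest = trans (sum-remove {i = a} (f off at a))
    (trans (cong₂ _+_ (cong (λ b → if b then + 0 else f a) (dec-true (a ≟ᶠ a) refl))
                      (sum-cong-≗ (λ j → off-at f (punchInᵢ≢i a j))))
           (ℤP.+-identityˡ _))

≤-+-nonneg : ∀ i {j} → + 0 ≤ j → i ≤ i + j
≤-+-nonneg i {j} j≥0 = subst (_≤ i + j) (ℤP.+-identityʳ i) (ℤP.+-monoʳ-≤ i j≥0)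

nonneg-+≡0 : ∀ {i j} → + 0 ≤ i → + 0 ≤ j → i + j ≡ + 0 → i ≡ + 0 × j ≡ + 0
nonneg-+≡0 {i} {j} i≥0 j≥0 i+j≡0 =
  ℤP.≤-antisym (subst (i ≤_) i+j≡0 (≤-+-nonneg i j≥0)) i≥0 ,
  ℤP.≤-antisym (subst (j ≤_) (trans (ℤP.+-comm j i) i+j≡0) (≤-+-nonneg j i≥0)) j≥0

nonneg-* : ∀ n {z} → + 0 ≤ z → + 0 ≤ + n * z
nonneg-* n {z} z≥0 = subst (_≤ + n * z) (ℤP.*-zeroʳ (+ n)) (ℤP.*-monoˡ-≤-nonNeg (+ n) z≥0)

term≤sum : ∀ {m} {f : Fin m → ℤ} (a : Fin m) → (∀ i → + 0 ≤ f i) → f a ≤ sum f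
term≤sum {f = f} a f≥0 = subst (f a ≤_) (sym (sum-extract f a))
  (≤-+-nonneg (f a) (sum-nonneg (off-nonneg (at a) f≥0)))

pair≤sum : ∀ {m} {f : Fin m → ℤ} {a b : Fin m} → a ≢ b → (∀ i → + 0 ≤ f i) → f a + f b ≤ sum f
pair≤sum {f = f} {a} {b} a≢b f≥0 = subst (f a + f b ≤_) (sym (sum-extract f a))
  (ℤP.+-monoʳ-≤ (f a) (subst (_≤ sum (f off at a)) (off-at f (a≢b ∘ sym))
    (term≤sum b (off-nonneg (at a) f≥0))))

nonneg-sum≤0 : ∀ {m} {f : Fin m → ℤ} → (∀ i → + 0 ≤ f i) → sum f ≤ + 0 → ∀ i → f i ≡ + 0
nonneg-sum≤0 f≥0 sum≤0 i = ℤP.≤-antisym (ℤP.≤-trans (term≤sum i f≥0) sum≤0) (f≥0 i)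

sum-single : ∀ {m} (f : Fin m → ℤ) (a : Fin m) → (∀ x → x ≢ a → f x ≡ + 0) → sum f ≡ f a
sum-single f a off-a = trans (sum-extract f a)
  (trans (cong (_+_ (f a)) (sum-zero vanish)) (ℤP.+-identityʳ (f a)))
  where
  vanish : ∀ x → (f off at a) x ≡ + 0
  vanish x with x ≟ᶠ a
  ... | yes _   = refl
  ... | no x≢a  = off-a x x≢a

sum-pair : ∀ {m} (f : Fin m → ℤ) {a b : Fin m} → a ≢ b →
  (∀ x → x ≢ a → x ≢ b → f x ≡ + 0) → sum f ≡ f a + f b
sum-pair f {a} {b} a≢b off-ab = trans (sum-extract f a)
  (cong (_+_ (f a)) (trans (sum-single (f off at a) b vanish) (off-at f (a≢b ∘ sym))))
  where
  vanish : ∀ x → x ≢ b → (f off at a) x ≡ + 0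
  vanish x x≢b with x ≟ᶠ a
  ... | yes _   = refl
  ... | no x≢a  = off-ab x x≢a x≢b

sum-sub : ∀ {m} (f g : Fin m → ℤ) → sum (λ i → f i - g i) ≡ sum f - sum g
sum-sub f g = trans (∑-distrib-+ f (λ i → - g i)) (cong (_+_ (sum f)) (sum-neg g))

module LaplacianFacts (G : Graph) where
  open Graph G

  laplacian-as-sum : ∀ (g : Vertex G → ℤ) x → Laplacian G g x ≡ sum (λ w → + adj x w * (g x - g w))
  laplacian-as-sum g x = begin
    + val G x * g x - ∑ℤ (λ w → + adj x w * g w)
      ≡⟨ cong₂ (λ s t → s * g x - t) (∑ℕ≡sum (adj x)) (∑ℤ≡sum (λ w → + adj x w * g w)) ⟩
    sum (λ w → + adj x w) * g x - sum (λ w → + adj x w * g w)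
      ≡⟨ cong (_- sum (λ w → + adj x w * g w)) (*-distribʳ-sum (g x) (λ w → + adj x w)) ⟩
    sum (λ w → + adj x w * g x) - sum (λ w → + adj x w * g w)
      ≡⟨ sym (sum-sub (λ w → + adj x w * g x) (λ w → + adj x w * g w)) ⟩
    sum (λ w → + adj x w * g x - + adj x w * g w)
      ≡⟨ sum-cong-≗ (λ w → factor (+ adj x w) (g x) (g w)) ⟩
    sum (λ w → + adj x w * (g x - g w)) ∎
    where
    open ≡-Reasoning
    factor : ∀ a b c → a * b - a * c ≡ a * (b - c)
    factor = solve-∀

  -- Σ_x (Δ g)(x) = 0: every edge contributes g x − g w at one end and g w − g x at the other.
  laplacian-sum-zero : ∀ (g : Vertex G → ℤ) → sum (Laplacian G g) ≡ + 0
  laplacian-sum-zero g = begin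
    sum (Laplacian G g)
      ≡⟨ sum-cong-≗ (λ x → trans (laplacian-as-sum g x) (sum-cong-≗ (λ w →
           trans (expand (+ adj x w) (g x) (g w)) (cong (λ k → out x w - + k * g w) (adj-sym x w))))) ⟩
    sum (λ x → sum (λ w → out x w - out w x))
      ≡⟨ sum-cong-≗ (λ x → sum-sub (out x) (λ w → out w x)) ⟩
    sum (λ x → sum (out x) - sum (λ w → out w x))
      ≡⟨ sum-sub (λ x → sum (out x)) (λ x → sum (λ w → out w x)) ⟩
    sum (λ x → sum (out x)) - sum (λ x → sum (λ w → out w x))
      ≡⟨ cong (_-_ (sum (λ x → sum (out x)))) (∑-comm (λ x w → out w x)) ⟩
    sum (λ x → sum (out x)) - sum (λ w → sum (out w))
      ≡⟨ ℤP.+-inverseʳ (sum (λ x → sum (out x))) ⟩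
    + 0 ∎
    where
    open ≡-Reasoning
    out : Vertex G → Vertex G → ℤ
    out x w = + adj x w * g x
    expand : ∀ a b c → a * (b - c) ≡ a * b - a * c
    expand = solve-∀

  equiv-same-degree : ∀ {E D} → Equiv G E D → sum E ≡ sum D
  equiv-same-degree {E} {D} (f , E-D≡Δf) = ℤP.i-j≡0⇒i≡j (sum E) (sum D)
    (trans (sym (sum-sub E D)) (trans (sum-cong-≗ E-D≡Δf) (laplacian-sum-zero f)))

  laplacian-sub : ∀ (g₁ g₂ : Vertex G → ℤ) x →
    Laplacian G (λ y → g₁ y - g₂ y) x ≡ Laplacian G g₁ x - Laplacian G g₂ x
  laplacian-sub g₁ g₂ x = begin
    Laplacian G (λ y → g₁ y - g₂ y) x
      ≡⟨ laplacian-as-sum (λ y → g₁ y - g₂ y) x ⟩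
    sum (λ w → + adj x w * ((g₁ x - g₂ x) - (g₁ w - g₂ w)))
      ≡⟨ sum-cong-≗ (λ w → regroup (+ adj x w) (g₁ x) (g₂ x) (g₁ w) (g₂ w)) ⟩
    sum (λ w → + adj x w * (g₁ x - g₁ w) - + adj x w * (g₂ x - g₂ w))
      ≡⟨ sum-sub (λ w → + adj x w * (g₁ x - g₁ w)) (λ w → + adj x w * (g₂ x - g₂ w)) ⟩
    sum (λ w → + adj x w * (g₁ x - g₁ w)) - sum (λ w → + adj x w * (g₂ x - g₂ w))
      ≡⟨ sym (cong₂ _-_ (laplacian-as-sum g₁ x) (laplacian-as-sum g₂ x)) ⟩
    Laplacian G g₁ x - Laplacian G g₂ x ∎
    where
    open ≡-Reasoning
    regroup : ∀ a b c d e → a * ((b - c) - (d - e)) ≡ a * (b - d) - a * (c - e)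
    regroup = solve-∀

  laplacian-neg : ∀ (g : Vertex G → ℤ) x → Laplacian G (λ y → - g y) x ≡ - Laplacian G g x
  laplacian-neg g x = begin
    Laplacian G (λ y → - g y) x
      ≡⟨ laplacian-as-sum (λ y → - g y) x ⟩
    sum (λ w → + adj x w * (- g x - - g w))
      ≡⟨ sum-cong-≗ (λ w → negate (+ adj x w) (g x) (g w)) ⟩
    sum (λ w → - (+ adj x w * (g x - g w)))
      ≡⟨ sum-neg (λ w → + adj x w * (g x - g w)) ⟩
    - sum (λ w → + adj x w * (g x - g w))
      ≡⟨ cong -_ (sym (laplacian-as-sum g x)) ⟩
    - Laplacian G g x ∎
    where
    open ≡-Reasoning
    negate : ∀ a b c → a * (- b - - c) ≡ - (a * (b - c))
    negate = solve-∀

  laplacian-const : ∀ (g : Vertex G → ℤ) c → (∀ y → g y ≡ c) → ∀ x → Laplacian G g x ≡ + 0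
  laplacian-const g c g≡c x = trans (laplacian-as-sum g x) (sum-zero vanish)
    where
    vanish : ∀ w → + adj x w * (g x - g w) ≡ + 0
    vanish w = begin
      + adj x w * (g x - g w) ≡⟨ cong₂ (λ s t → + adj x w * (s - t)) (g≡c x) (g≡c w) ⟩
      + adj x w * (c - c)     ≡⟨ cong (+ adj x w *_) (ℤP.+-inverseʳ c) ⟩
      + adj x w * + 0         ≡⟨ ℤP.*-zeroʳ (+ adj x w) ⟩
      + 0 ∎
      where open ≡-Reasoning

  constant-potential : ∀ (E E' : Divisor G) (h : Vertex G → ℤ) c → (∀ y → h y ≡ c) →
    (∀ x → E' x ≡ E x - Laplacian G h x) → ∀ x → E' x ≡ E x
  constant-potential E E' h c flat E'≡E-Δh x = trans (E'≡E-Δh x)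
    (trans (cong (_-_ (E x)) (laplacian-const h c flat x)) (ℤP.+-identityʳ (E x)))

  potential : ∀ {E E' D} → Equiv G E D → Equiv G E' D →
    ∃[ h ] (∀ x → E' x ≡ E x - Laplacian G h x)
  potential {E} {E'} {D} (f₁ , E-D≡Δf₁) (f₂ , E'-D≡Δf₂) = (λ y → f₁ y - f₂ y) , λ x →
    trans (rearrange (E x) (E' x) (D x)) (cong (_-_ (E x))
      (trans (cong₂ _-_ (E-D≡Δf₁ x) (E'-D≡Δf₂ x)) (sym (laplacian-sub f₁ f₂ x))))
    where
    rearrange : ∀ e e' d → e' ≡ e - ((e - d) - (e' - d))
    rearrange = solve-∀

  reverse-potential : ∀ (E E' : Divisor G) (h : Vertex G → ℤ) → (∀ x → E' x ≡ E x - Laplacian G h x) →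
    ∀ x → E x ≡ E' x - Laplacian G (λ y → - h y) x
  reverse-potential E E' h E'≡E-Δh x = begin
    E x                                    ≡⟨ cancel (E x) (Laplacian G h x) ⟩
    (E x - Laplacian G h x) - - Laplacian G h x ≡⟨ cong₂ _-_ (sym (E'≡E-Δh x)) (sym (laplacian-neg h x)) ⟩
    E' x - Laplacian G (λ y → - h y) x ∎
    where
    open ≡-Reasoning
    cancel : ∀ e l → e ≡ (e - l) - - l
    cancel = solve-∀

oneEdge : ∀ {m} → Fin m → Fin m → Fin m → Fin m → ℕ
oneEdge p q x w = if (does (x ≟ᶠ p) ∧ does (w ≟ᶠ q)) ∨ (does (x ≟ᶠ q) ∧ does (w ≟ᶠ p)) then 1 else 0

module _ {m : ℕ} {p q : Fin m} where

  oneEdge-sym : ∀ x w → oneEdge p q x w ≡ oneEdge p q w x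
  oneEdge-sym x w = cong (λ b → if b then 1 else 0)
    (trans (∨-comm (does (x ≟ᶠ p) ∧ does (w ≟ᶠ q)) _)
           (cong₂ _∨_ (∧-comm (does (x ≟ᶠ q)) _) (∧-comm (does (x ≟ᶠ p)) _)))

  oneEdge-≤1 : ∀ x w → oneEdge p q x w ℕ.≤ 1
  oneEdge-≤1 x w with (does (x ≟ᶠ p) ∧ does (w ≟ᶠ q)) ∨ (does (x ≟ᶠ q) ∧ does (w ≟ᶠ p))
  ... | true  = ℕP.≤-refl
  ... | false = ℕ.z≤n

  oneEdge-hit : oneEdge p q p q ≡ 1
  oneEdge-hit = cong (λ b → if b ∨ (does (p ≟ᶠ q) ∧ does (q ≟ᶠ p)) then 1 else 0)
    (cong₂ _∧_ (dec-true (p ≟ᶠ p) refl) (dec-true (q ≟ᶠ q) refl))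

  oneEdge-support : ∀ x w → oneEdge p q x w ≢ 0 → (x ≡ p × w ≡ q) ⊎ (x ≡ q × w ≡ p)
  oneEdge-support x w nonzero with x ≟ᶠ p | w ≟ᶠ q | x ≟ᶠ q | w ≟ᶠ p
  ... | yes x≡p | yes w≡q | _       | _       = inj₁ (x≡p , w≡q)
  ... | yes _   | no _    | yes x≡q | yes w≡p = inj₂ (x≡q , w≡p)
  ... | yes _   | no _    | yes _   | no _    = ⊥-elim (nonzero refl)
  ... | yes _   | no _    | no _    | _       = ⊥-elim (nonzero refl)
  ... | no _    | _       | yes x≡q | yes w≡p = inj₂ (x≡q , w≡p)
  ... | no _    | _       | yes _   | no _    = ⊥-elim (nonzero refl)
  ... | no _    | _       | no _    | _       = ⊥-elim (nonzero refl)

  module _ (p≢q : p ≢ q) where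

    oneEdge-loopless : ∀ x → oneEdge p q x x ≡ 0
    oneEdge-loopless x with oneEdge p q x x in e
    ... | zero  = refl
    ... | suc _ with oneEdge-support x x (λ e′ → ℕP.0≢1+n (trans (sym e′) e))
    ...   | inj₁ (x≡p , x≡q) = ⊥-elim (p≢q (trans (sym x≡p) x≡q))
    ...   | inj₂ (x≡q , x≡p) = ⊥-elim (p≢q (trans (sym x≡p) x≡q))

    oneEdge-total : sum (λ x → sum (λ w → + oneEdge p q x w)) ≡ + 2
    oneEdge-total = trans (sum-pair row p≢q off-pq) (cong₂ _+_ row-p row-q)
      where
      row : Fin m → ℤ
      row x = sum (λ w → + oneEdge p q x w)
      vanish : ∀ {x w} → ¬ ((x ≡ p × w ≡ q) ⊎ (x ≡ q × w ≡ p)) → + oneEdge p q x w ≡ + 0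
      vanish {x} {w} not-pq with oneEdge p q x w in e
      ... | zero  = refl
      ... | suc _ = ⊥-elim (not-pq (oneEdge-support x w (λ e′ → ℕP.0≢1+n (trans (sym e′) e))))
      off-pq : ∀ x → x ≢ p → x ≢ q → row x ≡ + 0
      off-pq x x≢p x≢q = sum-zero (λ w → vanish {x} {w} [ x≢p ∘ proj₁ , x≢q ∘ proj₁ ])
      row-p : row p ≡ + 1
      row-p = trans (sum-single (λ w → + oneEdge p q p w) q
                      (λ w w≢q → vanish {p} {w} [ w≢q ∘ proj₂ , p≢q ∘ proj₁ ]))
                    (cong +_ oneEdge-hit)
      row-q : row q ≡ + 1
      row-q = trans (sum-single (λ w → + oneEdge p q q w) p
                      (λ w w≢p → vanish {q} {w} [ p≢q ∘ sym ∘ proj₁ , w≢p ∘ proj₂ ]))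
                    (cong +_ (trans (oneEdge-sym q p) oneEdge-hit))

SingleEdge : Graph → Set
SingleEdge G = ∃[ a ] ∃[ b ] (Graph.adj G a b ≡ 1 × (∀ z → z ≡ a ⊎ z ≡ b))

first-step : ∀ {m} {a' : Fin m → Fin m → ℕ} {z y} → Reach a' z y → z ≢ y → ∃[ w ] (1 ℕ.≤ a' z w)
first-step here                  z≢z = ⊥-elim (z≢z refl)
first-step (step {w = w} 1≤zw _) _   = w , 1≤zw

has-neighbour : (G : Graph) → Connected G → ∀ {a b : Vertex G} → a ≢ b →
  ∀ z → ∃[ w ] (1 ℕ.≤ Graph.adj G z w)
has-neighbour G conn {a} {b} a≢b z with z ≟ᶠ a
... | yes z≡a = first-step (conn z b) (a≢b ∘ trans (sym z≡a))
... | no  z≢a = first-step (conn z a) z≢a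

leaving : (G : Graph) → (Vertex G → Bool) → Vertex G → Vertex G → ℤ
leaving G S x w = if S x then (if S w then + 0 else + Graph.adj G x w) else + 0

cutSize : (G : Graph) → (Vertex G → Bool) → ℤ
cutSize G S = sum (λ x → sum (leaving G S x))

double-sum : ∀ {m} (del : Fin m → Fin m → ℕ) →
  + ∑ℕ (λ u → ∑ℕ (λ v → del u v)) ≡ sum (λ x → sum (λ w → + del x w))
double-sum del = trans (∑ℕ≡sum (λ u → ∑ℕ (del u))) (sum-cong-≗ (λ x → ∑ℕ≡sum (del x)))

module Cut (G : Graph) (S : Vertex G → Bool) where
  open Graph G

  leaving-nonneg : ∀ x w → + 0 ≤ leaving G S x w
  leaving-nonneg x w with S x | S w
  ... | true  | true  = ℤP.≤-refl
  ... | true  | false = +≤+ ℕ.z≤n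
  ... | false | _     = ℤP.≤-refl

  cutSize-nonneg : + 0 ≤ cutSize G S
  cutSize-nonneg = sum-nonneg (λ x → sum-nonneg (leaving-nonneg x))

  leaving-from-outside : ∀ {x} → S x ≡ false → ∀ w → leaving G S x w ≡ + 0
  leaving-from-outside {x} ¬Sx w = cong (λ b → if b then (if S w then + 0 else + adj x w) else + 0) ¬Sx

  leaving-to-inside : ∀ {x w} → S w ≡ true → leaving G S x w ≡ + 0
  leaving-to-inside {x} {w} Sw with S x
  ... | true  = cong (λ c → if c then + 0 else + adj x w) Sw
  ... | false = refl

  leaving-across : ∀ {x w} → S x ≡ true → S w ≡ false → leaving G S x w ≡ + adj x w
  leaving-across {x} {w} Sx ¬Sw = cong₂ (λ b c → if b then (if c then + 0 else + adj x w) else + 0) Sx ¬Sw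

  edge≤leaving : ∀ {x w} → S x ≡ true → S w ≡ false → + adj x w ≤ sum (leaving G S x)
  edge≤leaving {x} {w} Sx ¬Sw =
    subst (_≤ sum (leaving G S x)) (leaving-across Sx ¬Sw) (term≤sum w (leaving-nonneg x))

  leaving≤cut : ∀ x → sum (leaving G S x) ≤ cutSize G S
  leaving≤cut x = term≤sum x (λ y → sum-nonneg (leaving-nonneg y))

  crossing-edges≤cut : ∀ {x w} → S x ≡ true → S w ≡ false → + adj x w ≤ cutSize G S
  crossing-edges≤cut {x} Sx ¬Sw = ℤP.≤-trans (edge≤leaving Sx ¬Sw) (leaving≤cut x)

  crossing : Vertex G → Vertex G → ℕ
  crossing x w = if S x xor S w then adj x w else 0

  crossing-sym : ∀ x w → crossing x w ≡ crossing w x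
  crossing-sym x w with S x | S w
  ... | true  | true  = refl
  ... | true  | false = adj-sym x w
  ... | false | true  = adj-sym x w
  ... | false | false = refl

  crossing-loopless : ∀ x → crossing x x ≡ 0
  crossing-loopless x = cong (λ b → if b then adj x x else 0) (xor-same (S x))

  crossing≤adj : ∀ x w → crossing x w ℕ.≤ adj x w
  crossing≤adj x w with S x xor S w
  ... | true  = ℕP.≤-refl
  ... | false = ℕ.z≤n

  crossing-between : ∀ {x w} → S x ≢ S w → crossing x w ≡ adj x w
  crossing-between {x} {w} Sx≢Sw with S x | S w
  ... | true  | true  = ⊥-elim (Sx≢Sw refl)
  ... | true  | false = refl
  ... | false | true  = refl
  ... | false | false = ⊥-elim (Sx≢Sw refl)

  crossing-within : ∀ {x w} → S x ≡ S w → crossing x w ≡ 0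
  crossing-within {x} {w} Sx≡Sw = trans (cong (λ b → if b xor S w then adj x w else 0) Sx≡Sw)
    (cong (λ b → if b then adj x w else 0) (xor-same (S w)))

  crossing-split : ∀ x w → + crossing x w ≡ leaving G S x w + leaving G S w x
  crossing-split x w with S x | S w
  ... | true  | true  = refl
  ... | true  | false = sym (ℤP.+-identityʳ _)
  ... | false | true  = trans (cong +_ (adj-sym x w)) (sym (ℤP.+-identityˡ _))
  ... | false | false = refl

  crossing-total : sum (λ x → sum (λ w → + crossing x w)) ≡ cutSize G S + cutSize G S
  crossing-total = begin
    sum (λ x → sum (λ w → + crossing x w))
      ≡⟨ sum-cong-≗ (λ x → trans (sum-cong-≗ (crossing-split x))
                                 (∑-distrib-+ (leaving G S x) (λ w → leaving G S w x))) ⟩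
    sum (λ x → sum (leaving G S x) + sum (λ w → leaving G S w x))
      ≡⟨ ∑-distrib-+ (λ x → sum (leaving G S x)) (λ x → sum (λ w → leaving G S w x)) ⟩
    cutSize G S + sum (λ x → sum (λ w → leaving G S w x))
      ≡⟨ cong (_+_ (cutSize G S)) (∑-comm (λ x w → leaving G S w x)) ⟩
    cutSize G S + cutSize G S ∎
    where open ≡-Reasoning

  crossing-two-edges : cutSize G S ≡ + 2 → TwoEdges G crossing
  crossing-two-edges cut≡2 = crossing-sym , crossing-loopless , crossing≤adj ,
    ℤP.+-injective (trans (double-sum crossing) (trans crossing-total (cong₂ _+_ cut≡2 cut≡2)))

  module CutAndInnerEdge {p q : Vertex G} (1≤pq : 1 ℕ.≤ adj p q) (Sp≡Sq : S p ≡ S q)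
    (cut≡1 : cutSize G S ≡ + 1) where

    p≢q : p ≢ q
    p≢q p≡q = ℕP.<⇒≢ 1≤pq (sym (trans (cong (adj p) (sym p≡q)) (loopless p)))

    del : Vertex G → Vertex G → ℕ
    del x w = crossing x w ℕ.+ oneEdge p q x w

    covers-cut : ∀ x w → S x ≢ S w → adj x w ℕ.≤ del x w
    covers-cut x w Sx≢Sw = subst (ℕ._≤ del x w) (crossing-between Sx≢Sw) (ℕP.m≤m+n _ _)

    inner-edge : ∀ {x w} → oneEdge p q x w ≢ 0 → 1 ℕ.≤ adj x w × S x ≡ S w
    inner-edge {x} {w} nonzero with oneEdge-support x w nonzero
    ... | inj₁ (refl , refl) = 1≤pq , Sp≡Sq
    ... | inj₂ (refl , refl) = subst (1 ℕ.≤_) (adj-sym p q) 1≤pq , sym Sp≡Sq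

    del≤adj : ∀ x w → del x w ℕ.≤ adj x w
    del≤adj x w with oneEdge p q x w ℕ.≟ 0
    ... | yes one≡0 = subst (λ k → crossing x w ℕ.+ k ℕ.≤ adj x w) (sym one≡0)
                        (subst (ℕ._≤ adj x w) (sym (ℕP.+-identityʳ _)) (crossing≤adj x w))
    ... | no  one≢0 = subst (λ c → c ℕ.+ oneEdge p q x w ℕ.≤ adj x w)
                        (sym (crossing-within (proj₂ (inner-edge one≢0))))
                        (ℕP.≤-trans (oneEdge-≤1 x w) (proj₁ (inner-edge one≢0)))

    total : + ∑ℕ (λ x → ∑ℕ (del x)) ≡ + 4
    total = begin
      + ∑ℕ (λ x → ∑ℕ (del x))
        ≡⟨ double-sum del ⟩
      sum (λ x → sum (λ w → + del x w))
        ≡⟨ sum-cong-≗ (λ x → trans (sum-cong-≗ (λ w → ℤP.pos-+ (crossing x w) (oneEdge p q x w)))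
                                   (∑-distrib-+ (λ w → + crossing x w) (λ w → + oneEdge p q x w))) ⟩
      sum (λ x → sum (λ w → + crossing x w) + sum (λ w → + oneEdge p q x w))
        ≡⟨ ∑-distrib-+ (λ x → sum (λ w → + crossing x w)) (λ x → sum (λ w → + oneEdge p q x w)) ⟩
      sum (λ x → sum (λ w → + crossing x w)) + sum (λ x → sum (λ w → + oneEdge p q x w))
        ≡⟨ cong₂ _+_ (trans crossing-total (cong₂ _+_ cut≡1 cut≡1)) (oneEdge-total p≢q) ⟩
      + 4 ∎
      where open ≡-Reasoning

    two-edges : TwoEdges G del
    two-edges = (λ x w → cong₂ ℕ._+_ (crossing-sym x w) (oneEdge-sym x w)) ,
                (λ x → cong₂ ℕ._+_ (crossing-loopless x) (oneEdge-loopless p≢q x)) ,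
                del≤adj , ℤP.+-injective total

  walk-same-side : (a' : Vertex G → Vertex G → ℕ) → (∀ x w → S x ≢ S w → a' x w ≡ 0) →
    ∀ {x y} → Reach a' x y → S x ≡ S y
  walk-same-side a' no-crossing here = refl
  walk-same-side a' no-crossing (step {x} {w} 1≤a'xw walk) with S x ≟ᵇ S w
  ... | yes Sx≡Sw = trans Sx≡Sw (walk-same-side a' no-crossing walk)
  ... | no  Sx≢Sw = ⊥-elim (ℕP.<⇒≢ 1≤a'xw (sym (no-crossing x w Sx≢Sw)))

  module Proper {a b : Vertex G} (Sa : S a ≡ true) (¬Sb : S b ≡ false) where

    separated : (a' : Vertex G → Vertex G → ℕ) → (∀ x w → S x ≢ S w → a' x w ≡ 0) →
      ConnectedAdj a' → ⊥
    separated a' no-crossing conn with trans (sym Sa) (trans (walk-same-side a' no-crossing (conn a b)) ¬Sb)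
    ... | ()

    cut≢0 : Connected G → cutSize G S ≢ + 0
    cut≢0 conn cut≡0 = separated adj no-crossing conn
      where
      no-edge : ∀ {x w} → S x ≡ true → S w ≡ false → adj x w ≡ 0
      no-edge {x} {w} Sx ¬Sw =
        ℕP.n≤0⇒n≡0 (ℤP.drop‿+≤+ (subst (+ adj x w ≤_) cut≡0 (crossing-edges≤cut Sx ¬Sw)))
      no-crossing : ∀ x w → S x ≢ S w → adj x w ≡ 0
      no-crossing x w Sx≢Sw with S x in Sx | S w in Sw
      ... | true  | true  = ⊥-elim (Sx≢Sw refl)
      ... | true  | false = no-edge Sx Sw
      ... | false | true  = trans (adj-sym x w) (no-edge Sw Sx)
      ... | false | false = ⊥-elim (Sx≢Sw refl)

    two-edges-not-covering-cut : ThreeEdgeConnected G → (del : Vertex G → Vertex G → ℕ) → TwoEdges G del →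
      (∀ x w → S x ≢ S w → adj x w ℕ.≤ del x w) → ⊥
    two-edges-not-covering-cut tec del two covers = separated _
      (λ x w Sx≢Sw → ℕP.m≤n⇒m∸n≡0 (covers x w Sx≢Sw)) (tec del two)

    cut≢2 : ThreeEdgeConnected G → cutSize G S ≢ + 2
    cut≢2 tec cut≡2 = two-edges-not-covering-cut tec crossing (crossing-two-edges cut≡2)
      (λ x w Sx≢Sw → ℕP.≤-reflexive (sym (crossing-between Sx≢Sw)))

    cut≢1 : ThreeEdgeConnected G → ∀ {p q} → 1 ℕ.≤ adj p q → S p ≡ S q → cutSize G S ≢ + 1
    cut≢1 tec 1≤pq Sp≡Sq cut≡1 = two-edges-not-covering-cut tec del two-edges covers-cut
      where open CutAndInnerEdge 1≤pq Sp≡Sq cut≡1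

    module AllEdgesCross (conn : Connected G) (bipartite : ∀ x w → 1 ℕ.≤ adj x w → S x ≢ S w)
      (cut≡1 : cutSize G S ≡ + 1) where

      private
        two≰one : ¬ (+ 2 ≤ + 1)
        two≰one (+≤+ (ℕ.s≤s ()))

      a≢b : a ≢ b
      a≢b a≡b with trans (sym Sa) (trans (cong S a≡b) ¬Sb)
      ... | ()

      across : ∀ {x w} → 1 ℕ.≤ adj x w → S w ≡ not (S x)
      across {x} {w} 1≤xw with S x | S w | bipartite x w 1≤xw
      ... | true  | true  | Sx≢Sw = ⊥-elim (Sx≢Sw refl)
      ... | true  | false | _     = refl
      ... | false | true  | _     = refl
      ... | false | false | Sx≢Sw = ⊥-elim (Sx≢Sw refl)

      -- every vertex of S has an edge leaving S, so S = {a}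
      leaving≥1 : ∀ {x} → S x ≡ true → + 1 ≤ sum (leaving G S x)
      leaving≥1 {x} Sx with has-neighbour G conn a≢b x
      ... | w , 1≤xw = ℤP.≤-trans (+≤+ 1≤xw) (edge≤leaving Sx (trans (across 1≤xw) (cong not Sx)))

      inside : ∀ {z} → S z ≡ true → z ≡ a
      inside {z} Sz with z ≟ᶠ a
      ... | yes z≡a = z≡a
      ... | no  z≢a = ⊥-elim (two≰one (begin
        + 2                                       ≤⟨ ℤP.+-mono-≤ (leaving≥1 Sz) (leaving≥1 Sa) ⟩
        sum (leaving G S z) + sum (leaving G S a) ≤⟨ pair≤sum z≢a (λ y → sum-nonneg (leaving-nonneg y)) ⟩
        cutSize G S                               ≡⟨ cut≡1 ⟩
        + 1                                       ∎))
        where open ℤP.≤-Reasoning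

      -- every vertex outside S is joined to a, so the complement of S is {b}
      joined-to-a : ∀ {z} → S z ≡ false → 1 ℕ.≤ adj a z
      joined-to-a {z} ¬Sz with has-neighbour G conn a≢b z
      ... | w , 1≤zw = subst (λ y → 1 ℕ.≤ adj y z) (inside (trans (across 1≤zw) (cong not ¬Sz)))
                         (subst (1 ℕ.≤_) (adj-sym z w) 1≤zw)

      outside : ∀ {z} → S z ≡ false → z ≡ b
      outside {z} ¬Sz with z ≟ᶠ b
      ... | yes z≡b = z≡b
      ... | no  z≢b = ⊥-elim (two≰one (begin
        + 2                                  ≤⟨ ℤP.+-mono-≤ (+≤+ (joined-to-a ¬Sz)) (+≤+ (joined-to-a ¬Sb)) ⟩
        + adj a z + + adj a b                ≡⟨ sym (cong₂ _+_ (leaving-across Sa ¬Sz) (leaving-across Sa ¬Sb)) ⟩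
        leaving G S a z + leaving G S a b    ≤⟨ pair≤sum z≢b (leaving-nonneg a) ⟩
        sum (leaving G S a)                  ≤⟨ leaving≤cut a ⟩
        cutSize G S                          ≡⟨ cut≡1 ⟩
        + 1                                  ∎))
        where open ℤP.≤-Reasoning

      single-edge : SingleEdge G
      single-edge = a , b , adj-ab≡1 , side
        where
        side : ∀ z → z ≡ a ⊎ z ≡ b
        side z with S z in Sz
        ... | true  = inj₁ (inside Sz)
        ... | false = inj₂ (outside Sz)
        adj-ab≡1 : adj a b ≡ 1
        adj-ab≡1 = ℕP.≤-antisym (ℤP.drop‿+≤+ (subst (+ adj a b ≤_) cut≡1 (crossing-edges≤cut Sa ¬Sb)))
                                (joined-to-a ¬Sb)

cut≥3 : (G : Graph) → Connected G → ThreeEdgeConnected G → ¬ SingleEdge G →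
  ∀ (S : Vertex G → Bool) {a b} → S a ≡ true → S b ≡ false → + 3 ≤ cutSize G S
cut≥3 G conn tec not-single S Sa ¬Sb = by-size ℤ.∣ cutSize G S ∣ (sym (ℤP.0≤i⇒+∣i∣≡i cutSize-nonneg))
  where
  open Graph G
  open Cut G S
  open Proper Sa ¬Sb
  by-size : ∀ k → cutSize G S ≡ + k → + 3 ≤ cutSize G S
  by-size 0 cut≡0 = ⊥-elim (cut≢0 conn cut≡0)
  by-size 1 cut≡1 with any? (λ p → any? (λ q → (1 ℕ.≤? adj p q) ×-dec (S p ≟ᵇ S q)))
  ... | yes (p , q , 1≤pq , Sp≡Sq) = ⊥-elim (cut≢1 tec 1≤pq Sp≡Sq cut≡1)
  ... | no  no-inner-edge = ⊥-elim (not-single (AllEdgesCross.single-edge conn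
          (λ x w 1≤xw Sx≡Sw → no-inner-edge (x , w , 1≤xw , Sx≡Sw)) cut≡1))
  by-size 2 cut≡2 = ⊥-elim (cut≢2 tec cut≡2)
  by-size (suc (suc (suc k))) cut≡k = subst (+ 3 ≤_) (sym cut≡k) (+≤+ (ℕ.s≤s (ℕ.s≤s (ℕ.s≤s ℕ.z≤n))))

module SingleEdgeGraph (G : Graph) {a b : Vertex G} (adj-ab≡1 : Graph.adj G a b ≡ 1)
  (side : ∀ z → z ≡ a ⊎ z ≡ b) where
  open Graph G
  open LaplacianFacts G

  a≢b : a ≢ b
  a≢b a≡b = ℕP.0≢1+n (trans (sym (loopless a)) (trans (cong (adj a) a≡b) adj-ab≡1))

  sum-over-edge : ∀ (h : Vertex G → ℤ) → sum h ≡ h a + h b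
  sum-over-edge h = sum-pair h a≢b (λ z z≢a z≢b → ⊥-elim ([ z≢a , z≢b ] (side z)))

  laplacian-at-end : ∀ {x y} → x ≢ y → (∀ z → z ≡ x ⊎ z ≡ y) → adj x y ≡ 1 →
    ∀ (f : Vertex G → ℤ) → Laplacian G f x ≡ f x - f y
  laplacian-at-end {x} {y} x≢y only-xy adj-xy≡1 f = begin
    Laplacian G f x                                     ≡⟨ laplacian-as-sum f x ⟩
    sum (λ w → + adj x w * (f x - f w))                 ≡⟨ sum-pair (λ w → + adj x w * (f x - f w)) x≢y
                                                             (λ z z≢x z≢y → ⊥-elim ([ z≢x , z≢y ] (only-xy z))) ⟩
    + adj x x * (f x - f x) + + adj x y * (f x - f y)   ≡⟨ cong₂ (λ s t → + s * (f x - f x) + + t * (f x - f y))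
                                                             (loopless x) adj-xy≡1 ⟩
    + 0 * (f x - f x) + + 1 * (f x - f y)               ≡⟨ simplify (f x) (f y) ⟩
    f x - f y                                           ∎
    where
    open ≡-Reasoning
    simplify : ∀ i j → + 0 * (i - i) + + 1 * (i - j) ≡ i - j
    simplify = solve-∀

  degree-one : ∀ (X : Divisor G) → sum X ≡ + 1 → Equiv G ((λ _ → + 1) on at a) X
  degree-one X degX = f , E-X≡Δf
    where
    at-a : at a a ≡ true
    at-a = dec-true (a ≟ᶠ a) refl
    at-b : at a b ≡ false
    at-b = dec-false (b ≟ᶠ a) (a≢b ∘ sym)
    E f : Vertex G → ℤ
    E = (λ _ → + 1) on at a
    f = (λ _ → X b) on at a
    E-a : E a ≡ + 1
    E-a = on-inside (λ _ → + 1) (at a) {a} at-a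
    E-b : E b ≡ + 0
    E-b = on-outside (λ _ → + 1) (at a) {b} at-b
    f-a : f a ≡ X b
    f-a = on-inside (λ _ → X b) (at a) {a} at-a
    f-b : f b ≡ + 0
    f-b = on-outside (λ _ → X b) (at a) {b} at-b
    E-X≡Δf : ∀ z → E z - X z ≡ Laplacian G f z
    E-X≡Δf z with side z
    ... | inj₁ refl = begin
      E a - X a            ≡⟨ cong (_- X a) (trans E-a (trans (sym degX) (sum-over-edge X))) ⟩
      X a + X b - X a      ≡⟨ cancel (X a) (X b) ⟩
      X b - + 0            ≡⟨ sym (cong₂ _-_ f-a f-b) ⟩
      f a - f b            ≡⟨ sym (laplacian-at-end a≢b side adj-ab≡1 f) ⟩
      Laplacian G f a      ∎
      where
      open ≡-Reasoning
      cancel : ∀ i j → i + j - i ≡ j - + 0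
      cancel = solve-∀
    ... | inj₂ refl = begin
      E b - X b            ≡⟨ cong (_- X b) E-b ⟩
      + 0 - X b            ≡⟨ sym (cong₂ _-_ f-b f-a) ⟩
      f b - f a            ≡⟨ sym (laplacian-at-end (a≢b ∘ sym) (swap ∘ side) (trans (adj-sym b a) adj-ab≡1) f) ⟩
      Laplacian G f b      ∎
      where open ≡-Reasoning

  rank-condition : ∀ (D : Divisor G) k → deg G D ≡ + suc k → RankCond G D k
  rank-condition D k degD F F≥0 degF =
    (λ _ → + 1) on at a , on-nonneg (at a) (λ _ → +≤+ ℕ.z≤n) , degree-one (_-ᴰ_ {G} D F) deg-D-F
    where
    deg-D-F : sum (_-ᴰ_ {G} D F) ≡ + 1
    deg-D-F = begin
      sum (_-ᴰ_ {G} D F)   ≡⟨ sum-sub D F ⟩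
      sum D - sum F        ≡⟨ cong₂ _-_ (trans (sym (∑ℤ≡sum D)) degD) (trans (sym (∑ℤ≡sum F)) degF) ⟩
      + 1 + + k - + k      ≡⟨ cancel (+ k) ⟩
      + 1                  ∎
      where
      open ≡-Reasoning
      cancel : ∀ j → + 1 + j - j ≡ + 1
      cancel = solve-∀

-- A divisor of rank 1 and degree 3 cannot live on a single edge, where it would have rank ≥ 2.
rank-one-not-single-edge : (G : Graph) (D : Divisor G) → HasRank G D (+ 1) → deg G D ≡ + 3 → ¬ SingleEdge G
rank-one-not-single-edge G D (inj₁ (() , _))
rank-one-not-single-edge G D (inj₂ (k , 1≡k , _ , no-higher-rank)) degD (a , b , adj-ab≡1 , side) =
  no-higher-rank 2 (subst (ℕ._< 2) (ℤP.+-injective 1≡k) (ℕ.s≤s (ℕ.s≤s ℕ.z≤n)))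
    (SingleEdgeGraph.rank-condition G adj-ab≡1 side D 2 degD)

level : ∀ {m} → (Fin m → ℤ) → ℤ → Fin m → Bool
level g c x = does (g x ℤ.≟ c)

-- Summing E' over the top level set T = {g = M} gives
--   Σ_T E' = Σ_T E − (edges leaving T) − Σ_T (excess drops of g) ≤ k − k − 0,
-- so every term is extremal: E is supported on T, E' vanishes on T, g drops by exactly 1 along every
-- edge leaving T, and E x counts the edges leaving T at x.
module TopLevel (G : Graph) (k : ℕ)
  (cuts≥k : ∀ (S : Vertex G → Bool) {a b} → S a ≡ true → S b ≡ false → + k ≤ cutSize G S)
  (g : Vertex G → ℤ) (a : Vertex G) (a-max : ∀ x → g x ≤ g a) {b : Vertex G} (g-b≢g-a : g b ≢ g a)
  (E E' : Divisor G) (E≥0 : Effective G E) (E'≥0 : Effective G E')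
  (degE : sum E ≡ + k) (E'≡E-Δg : ∀ x → E' x ≡ E x - Laplacian G g x) where
  open Graph G
  open LaplacianFacts G
  open Cut G (level g (g a))

  M : ℤ
  M = g a

  T : Vertex G → Bool
  T = level g M

  on-top : ∀ {x} → g x ≡ M → T x ≡ true
  on-top {x} = dec-true (g x ℤ.≟ M)

  off-top : ∀ {x} → g x ≢ M → T x ≡ false
  off-top {x} = dec-false (g x ℤ.≟ M)

  -- the drop of g from M to w, beyond the one unit forced by leaving T
  drop : Vertex G → ℤ
  drop w = (M - g w) - (if T w then + 0 else + 1)

  drop-nonneg : ∀ w → + 0 ≤ drop w
  drop-nonneg w with g w ℤ.≟ M
  ... | yes g-w≡M = ℤP.≤-reflexive (sym (trans (cong (λ t → (M - t) - + 0) g-w≡M) (cancel M)))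
    where
    cancel : ∀ m → (m - m) - + 0 ≡ + 0
    cancel = solve-∀
  ... | no  g-w≢M = subst (+ 0 ≤_) (shift M (g w))
    (ℤP.i≤j⇒0≤j-i (ℤP.i<j⇒suc[i]≤j (ℤP.≤∧≢⇒< (a-max w) g-w≢M)))
    where
    shift : ∀ m y → m - (+ 1 + y) ≡ (m - y) - + 1
    shift = solve-∀

  excess : Vertex G → Vertex G → ℤ
  excess x w = + adj x w * drop w

  excess-nonneg : ∀ x w → + 0 ≤ excess x w
  excess-nonneg x w = nonneg-* (adj x w) (drop-nonneg w)

  laplacian-on-top : ∀ {x} → g x ≡ M → Laplacian G g x ≡ sum (leaving G T x) + sum (excess x)
  laplacian-on-top {x} g-x≡M = trans (laplacian-as-sum g x)
    (trans (sum-cong-≗ split) (∑-distrib-+ (leaving G T x) (excess x)))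
    where
    split : ∀ w → + adj x w * (g x - g w) ≡ leaving G T x w + excess x w
    split w rewrite on-top g-x≡M | g-x≡M with T w
    ... | true  = at-level (+ adj x w) M (g w)
      where
      at-level : ∀ p m y → p * (m - y) ≡ + 0 + p * ((m - y) - + 0)
      at-level = solve-∀
    ... | false = below (+ adj x w) M (g w)
      where
      below : ∀ p m y → p * (m - y) ≡ p + p * ((m - y) - + 1)
      below = solve-∀

  excessAt : Vertex G → ℤ
  excessAt x = sum (excess x)

  balance : sum (E' on T) ≡ sum (E on T) - (cutSize G T + sum (excessAt on T))
  balance = begin
    sum (E' on T)
      ≡⟨ sum-cong-≗ pointwise ⟩
    sum (λ x → (E on T) x - (sum (leaving G T x) + (excessAt on T) x))
      ≡⟨ sum-sub (E on T) (λ x → sum (leaving G T x) + (excessAt on T) x) ⟩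
    sum (E on T) - sum (λ x → sum (leaving G T x) + (excessAt on T) x)
      ≡⟨ cong (_-_ (sum (E on T))) (∑-distrib-+ (λ x → sum (leaving G T x)) (excessAt on T)) ⟩
    sum (E on T) - (cutSize G T + sum (excessAt on T)) ∎
    where
    open ≡-Reasoning
    pointwise : ∀ x → (E' on T) x ≡ (E on T) x - (sum (leaving G T x) + (excessAt on T) x)
    pointwise x = by-level (g x ℤ.≟ M)
      where
      by-level : Dec (g x ≡ M) → (E' on T) x ≡ (E on T) x - (sum (leaving G T x) + (excessAt on T) x)
      by-level (yes g-x≡M) = begin
        (E' on T) x                               ≡⟨ on-inside E' T Tx ⟩
        E' x                                      ≡⟨ E'≡E-Δg x ⟩
        E x - Laplacian G g x                     ≡⟨ cong (_-_ (E x)) (laplacian-on-top g-x≡M) ⟩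
        E x - (sum (leaving G T x) + excessAt x)  ≡⟨ sym (cong₂ (λ e d → e - (sum (leaving G T x) + d))
                                                           (on-inside E T Tx) (on-inside excessAt T Tx)) ⟩
        (E on T) x - (sum (leaving G T x) + (excessAt on T) x) ∎
        where Tx = on-top g-x≡M
      by-level (no g-x≢M) = begin
        (E' on T) x                               ≡⟨ on-outside E' T ¬Tx ⟩
        + 0 - (+ 0 + + 0)                         ≡⟨ sym (cong₂ _-_ (on-outside E T ¬Tx)
                                                           (cong₂ _+_ (sum-zero (leaving-from-outside ¬Tx))
                                                                      (on-outside excessAt T ¬Tx))) ⟩
        (E on T) x - (sum (leaving G T x) + (excessAt on T) x) ∎
        where ¬Tx = off-top g-x≢M

  -- The balance rearranged: four nonnegative quantities add up to 0, so all of them vanish.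
  private
    E'-mass≥0 : + 0 ≤ sum (E' on T)
    E'-mass≥0 = sum-nonneg (on-nonneg T E'≥0)

    excess-mass≥0 : + 0 ≤ sum (excessAt on T)
    excess-mass≥0 = sum-nonneg (on-nonneg T (λ x → sum-nonneg (excess-nonneg x)))

    E-deficit≥0 : + 0 ≤ + k - sum (E on T)
    E-deficit≥0 = ℤP.i≤j⇒0≤j-i (subst (sum (E on T) ≤_) (trans (sym (sum-on-off E T)) degE)
      (≤-+-nonneg (sum (E on T)) (sum-nonneg (off-nonneg T E≥0))))

    cut-surplus≥0 : + 0 ≤ cutSize G T - + k
    cut-surplus≥0 = ℤP.i≤j⇒0≤j-i (cuts≥k T (on-top refl) (off-top g-b≢g-a))

    extremal : (sum (E' on T) + sum (excessAt on T)) + ((+ k - sum (E on T)) + (cutSize G T - + k)) ≡ + 0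
    extremal = trans (cong (λ e' → (e' + sum (excessAt on T)) + ((+ k - sum (E on T)) + (cutSize G T - + k))) balance)
      (cancel (sum (E on T)) (cutSize G T) (sum (excessAt on T)) (+ k))
      where
      cancel : ∀ e c d κ → ((e - (c + d)) + d) + ((κ - e) + (c - κ)) ≡ + 0
      cancel = solve-∀

    halves : sum (E' on T) + sum (excessAt on T) ≡ + 0 × (+ k - sum (E on T)) + (cutSize G T - + k) ≡ + 0
    halves = nonneg-+≡0 (ℤP.+-mono-≤ E'-mass≥0 excess-mass≥0) (ℤP.+-mono-≤ E-deficit≥0 cut-surplus≥0)
      extremal

    E'-mass≡0 : sum (E' on T) ≡ + 0
    E'-mass≡0 = proj₁ (nonneg-+≡0 E'-mass≥0 excess-mass≥0 (proj₁ halves))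

    excess-mass≡0 : sum (excessAt on T) ≡ + 0
    excess-mass≡0 = proj₂ (nonneg-+≡0 E'-mass≥0 excess-mass≥0 (proj₁ halves))

    E-deficit≡0 : + k - sum (E on T) ≡ + 0
    E-deficit≡0 = proj₁ (nonneg-+≡0 E-deficit≥0 cut-surplus≥0 (proj₂ halves))

    E-off-T≡0 : sum (E off T) ≡ + 0
    E-off-T≡0 = begin
      sum (E off T)                         ≡⟨ solve (sum (E on T)) (sum (E off T)) ⟩
      (sum (E on T) + sum (E off T)) - sum (E on T) ≡⟨ cong (_- sum (E on T)) (trans (sym (sum-on-off E T)) degE) ⟩
      + k - sum (E on T)                    ≡⟨ E-deficit≡0 ⟩
      + 0                                   ∎
      where
      open ≡-Reasoning
      solve : ∀ i j → j ≡ (i + j) - i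
      solve = solve-∀

  supp-E⊆T : ∀ {x} → + 0 < E x → g x ≡ M
  supp-E⊆T {x} 0<Ex with g x ℤ.≟ M
  ... | yes g-x≡M = g-x≡M
  ... | no  g-x≢M = ⊥-elim (ℤP.<-irrefl refl (ℤP.<-≤-trans 0<Ex (ℤP.≤-reflexive
          (trans (sym (off-outside E T (off-top g-x≢M)))
                 (nonneg-sum≤0 (off-nonneg T E≥0) (ℤP.≤-reflexive E-off-T≡0) x)))))

  E'-vanishes : ∀ {x} → g x ≡ M → E' x ≡ + 0
  E'-vanishes {x} g-x≡M =
    trans (sym (on-inside E' T (on-top g-x≡M))) (nonneg-sum≤0 (on-nonneg T E'≥0) (ℤP.≤-reflexive E'-mass≡0) x)

  excess-vanishes : ∀ {x} → g x ≡ M → ∀ w → excess x w ≡ + 0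
  excess-vanishes {x} g-x≡M = nonneg-sum≤0 (excess-nonneg x) (ℤP.≤-reflexive
    (trans (sym (on-inside excessAt T (on-top g-x≡M)))
           (nonneg-sum≤0 (on-nonneg T (λ y → sum-nonneg (excess-nonneg y))) (ℤP.≤-reflexive excess-mass≡0) x)))

  E-counts-leaving : ∀ {x} → g x ≡ M → E x ≡ sum (leaving G T x)
  E-counts-leaving {x} g-x≡M = begin
    E x                                        ≡⟨ ℤP.i-j≡0⇒i≡j (E x) (Laplacian G g x)
                                                    (trans (sym (E'≡E-Δg x)) (E'-vanishes g-x≡M)) ⟩
    Laplacian G g x                            ≡⟨ laplacian-on-top g-x≡M ⟩
    sum (leaving G T x) + sum (excess x)       ≡⟨ cong (_+_ (sum (leaving G T x))) (sum-zero (excess-vanishes g-x≡M)) ⟩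
    sum (leaving G T x) + + 0                  ≡⟨ ℤP.+-identityʳ _ ⟩
    sum (leaving G T x)                        ∎
    where open ≡-Reasoning

  edge≤E : ∀ {x w} → g x ≡ M → g w ≢ M → + adj x w ≤ E x
  edge≤E {x} {w} g-x≡M g-w≢M =
    subst (+ adj x w ≤_) (sym (E-counts-leaving g-x≡M)) (edge≤leaving (on-top g-x≡M) (off-top g-w≢M))

  step-down : ∀ {x w} → g x ≡ M → g w ≢ M → 1 ℕ.≤ adj x w → g w ≡ M - + 1
  step-down {x} {w} g-x≡M g-w≢M 1≤xw with ℤP.i*j≡0⇒i≡0∨j≡0 (+ adj x w) (excess-vanishes g-x≡M w)
  ... | inj₁ adj≡0  = ⊥-elim (ℕP.<⇒≢ 1≤xw (sym (ℤP.+-injective adj≡0)))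
  ... | inj₂ drop≡0 = sym (ℤP.i-j≡0⇒i≡j (M - + 1) (g w) (trans (rearrange M (g w))
          (trans (cong (λ t → (M - g w) - (if t then + 0 else + 1)) (sym (off-top g-w≢M))) drop≡0)))
    where
    rearrange : ∀ m y → (m - + 1) - y ≡ (m - y) - + 1
    rearrange = solve-∀

maximiser : ∀ {m} → Fin m → (g : Fin m → ℤ) → ∃[ a ] (∀ x → g x ≤ g a)
maximiser x₀ g = argmax g x₀ (allFin _) , λ x → All.lookup (f[xs]≤f[argmax] {f = g} x₀ (allFin _)) (∈-allFin x)

constant-or-not : ∀ {m} (g : Fin m → ℤ) (a : Fin m) → (∀ x → g x ≡ g a) ⊎ ∃[ b ] (g b ≢ g a)
constant-or-not {m} g a with all? (λ x → g x ℤ.≟ g a)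
... | yes flat    = inj₁ flat
... | no  ¬flat   = inj₂ (¬∀⟶∃¬ m _ (λ x → g x ℤ.≟ g a) ¬flat)

other-value : ∀ {m} (g : Fin m → ℤ) {b c : Fin m} → g b ≢ g c → ∀ a → ∃[ d ] (g d ≢ g a)
other-value g {b} {c} g-b≢g-c a with g b ℤ.≟ g a
... | yes g-b≡g-a = c , λ g-c≡g-a → g-b≢g-c (trans g-b≡g-a (sym g-c≡g-a))
... | no  g-b≢g-a = b , g-b≢g-a

pos-sound : ∀ {z} → pos z ≡ true → + 0 < z
pos-sound {+[1+ n ]} _ = +<+ (ℕ.s≤s ℕ.z≤n)

pos-complete : ∀ {z} → + 0 < z → pos z ≡ true
pos-complete {+[1+ n ]} _         = refl
pos-complete {+ zero}   (+<+ ())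

not-pos : ∀ {z} → pos z ≡ false → ¬ (+ 0 < z)
not-pos pos-z≡false 0<z with trans (sym (pos-complete 0<z)) pos-z≡false
... | ()

pos-zero : ∀ {z} → z ≡ + 0 → pos z ≡ false
pos-zero refl = refl

module EffectiveRepresentatives (G : Graph)
  (cuts≥3 : ∀ (S : Vertex G → Bool) {a b} → S a ≡ true → S b ≡ false → + 3 ≤ cutSize G S)
  (D : Divisor G) (degD : deg G D ≡ + 3) where
  open Graph G
  open LaplacianFacts G

  degree-3 : ∀ {E} → Equiv G E D → sum E ≡ + 3
  degree-3 {E} E∼D = trans (equiv-same-degree {E} E∼D) (trans (sym (∑ℤ≡sum D)) degD)

  unique : ∀ {E E'} → Effective G E → Effective G E' → Equiv G E D → Equiv G E' D →
    ∀ {x} → + 0 < E x → + 0 < E' x → ∀ y → E y ≡ E' y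
  unique {E} {E'} E≥0 E'≥0 E∼D E'∼D {x} 0<Ex 0<E'x with potential {E} {E'} E∼D E'∼D
  ... | h , E'≡E-Δh with maximiser x h
  ... | a , a-max with constant-or-not h a
  ... | inj₁ flat           = λ y → sym (constant-potential E E' h (h a) flat E'≡E-Δh y)
  ... | inj₂ (b , h-b≢h-a) = ⊥-elim (ℤP.<-irrefl (sym (Top.E'-vanishes (Top.supp-E⊆T 0<Ex))) 0<E'x)
    where module Top = TopLevel G 3 cuts≥3 h a a-max h-b≢h-a E E' E≥0 E'≥0 (degree-3 {E} E∼D) E'≡E-Δh

  -- Applying the top-level lemma to h
  -- and to −h shows: supp Du lies in T = {h = M}, supp Dv in the bottom level {h = M − 1}, and every
  -- edge leaving T ends in supp Dv.
  module Adjacent {Du Dv : Divisor G} (Du≥0 : Effective G Du) (Dv≥0 : Effective G Dv)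
    (Du∼D : Equiv G Du D) (Dv∼D : Equiv G Dv D)
    (h : Vertex G → ℤ) (Dv≡Du-Δh : ∀ x → Dv x ≡ Du x - Laplacian G h x)
    (a : Vertex G) (a-max : ∀ x → h x ≤ h a) {b : Vertex G} (h-b≢h-a : h b ≢ h a)
    {u v : Vertex G} (0<Du-u : + 0 < Du u) (0<Dv-v : + 0 < Dv v) (1≤uv : 1 ℕ.≤ adj u v) where

    module Up = TopLevel G 3 cuts≥3 h a a-max h-b≢h-a Du Dv Du≥0 Dv≥0 (degree-3 {Du} Du∼D) Dv≡Du-Δh
    open Up using (M; T)

    Dv-off-top : ∀ {w} → + 0 < Dv w → h w ≢ M
    Dv-off-top 0<Dv-w h-w≡M = ℤP.<-irrefl (sym (Up.E'-vanishes h-w≡M)) 0<Dv-w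

    h-v : h v ≡ M - + 1
    h-v = Up.step-down (Up.supp-E⊆T 0<Du-u) (Dv-off-top 0<Dv-v) 1≤uv

    -h : Vertex G → ℤ
    -h y = - h y

    bottom : Vertex G
    bottom = proj₁ (maximiser v -h)

    module Down = TopLevel G 3 cuts≥3 -h bottom (proj₂ (maximiser v -h))
      (proj₂ (other-value -h (λ e → h-b≢h-a (ℤP.neg-injective e)) bottom))
      Dv Du Dv≥0 Du≥0 (degree-3 {Dv} Dv∼D) (reverse-potential Du Dv h Dv≡Du-Δh)

    leaving-edge-into-Dv : ∀ {x w} → h x ≡ M → h w ≢ M → 1 ℕ.≤ adj x w → + 0 < Dv w
    leaving-edge-into-Dv {x} {w} h-x≡M h-w≢M 1≤xw = ℤP.<-≤-trans (+<+ (subst (1 ℕ.≤_) (adj-sym x w) 1≤xw))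
      (Down.edge≤E w-at-bottom x-not-at-bottom)
      where
      v-at-bottom : -h v ≡ Down.M
      v-at-bottom = Down.supp-E⊆T 0<Dv-v
      w-at-bottom : -h w ≡ Down.M
      w-at-bottom = trans (cong -_ (trans (Up.step-down h-x≡M h-w≢M 1≤xw) (sym h-v))) v-at-bottom
      x-not-at-bottom : -h x ≢ Down.M
      x-not-at-bottom -h-x≡bottom = Dv-off-top 0<Dv-v
        (trans (ℤP.neg-injective (trans v-at-bottom (sym -h-x≡bottom))) h-x≡M)

    -- Seen from a vertex of T, the edges into supp Dv are exactly the edges leaving T.
    edgesTo-Dv : ∀ {x} → h x ≡ M → + edgesTo G x Dv ≡ Du x
    edgesTo-Dv {x} h-x≡M = begin
      + edgesTo G x Dv                                   ≡⟨ ∑ℕ≡sum (λ w → if pos (Dv w) then adj x w else 0) ⟩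
      sum (λ w → + (if pos (Dv w) then adj x w else 0)) ≡⟨ sum-cong-≗ (λ w → by-level w (h w ℤ.≟ M)) ⟩
      sum (leaving G T x)                                ≡⟨ sym (Up.E-counts-leaving h-x≡M) ⟩
      Du x                                               ∎
      where
      open ≡-Reasoning
      open Cut G T
      by-level : ∀ w → Dec (h w ≡ M) → + (if pos (Dv w) then adj x w else 0) ≡ leaving G T x w
      by-level w (yes h-w≡M) = trans (cong (λ p → + (if p then adj x w else 0)) (pos-zero (Up.E'-vanishes h-w≡M)))
                                     (sym (leaving-to-inside (Up.on-top h-w≡M)))
      by-level w (no  h-w≢M) = trans tally (sym (leaving-across (Up.on-top h-x≡M) (Up.off-top h-w≢M)))
        where
        tally : + (if pos (Dv w) then adj x w else 0) ≡ + adj x w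
        tally with pos (Dv w) in pos-Dv-w
        ... | true  = refl
        ... | false = cong +_ (sym (ℕP.n≤0⇒n≡0 (ℕP.≮⇒≥ λ 1≤xw →
                        not-pos pos-Dv-w (leaving-edge-into-Dv h-x≡M h-w≢M 1≤xw))))

  adjacent-classes : (u v : Vertex G) → 1 ℕ.≤ adj u v →
    (Du : Divisor G) → Effective G Du → Equiv G Du D → InSupp G u Du →
    (Dv : Divisor G) → Effective G Dv → Equiv G Dv D → InSupp G v Dv →
    ¬ SameSupp G Du Dv →
    (edgesBetween G Du Dv ≡ 3)
    × ((u' : Vertex G) → InSupp G u' Du →
       (Du' : Divisor G) → Effective G Du' → Equiv G Du' D → InSupp G u' Du' →
       + edgesTo G u' Dv ≡ Du' u')
  adjacent-classes u v 1≤uv Du Du≥0 Du∼D 0<Du-u Dv Dv≥0 Dv∼D 0<Dv-v different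
    with potential {Du} {Dv} Du∼D Dv∼D
  ... | h , Dv≡Du-Δh with maximiser u h
  ... | a , a-max with constant-or-not h a
  ... | inj₁ flat = ⊥-elim (different (λ y →
          let Dv-y≡Du-y = constant-potential Du Dv h (h a) flat Dv≡Du-Δh y
          in subst (+ 0 <_) (sym Dv-y≡Du-y) , subst (+ 0 <_) Dv-y≡Du-y))
  ... | inj₂ (b , h-b≢h-a) = three-edges , edges-from-u'
    where
    open Adjacent Du≥0 Dv≥0 Du∼D Dv∼D h Dv≡Du-Δh a a-max h-b≢h-a 0<Du-u 0<Dv-v 1≤uv

    row : ∀ x → + ∑ℕ (λ w → if pos (Du x) ∧ pos (Dv w) then adj x w else 0) ≡ Du x
    row x with pos (Du x) in pos-Du-x
    ... | true  = edgesTo-Dv (Up.supp-E⊆T (pos-sound pos-Du-x))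
    ... | false = trans (trans (∑ℕ≡sum {n} (λ _ → 0)) (sum-zero {n} {λ _ → + 0} (λ _ → refl)))
                        (ℤP.≤-antisym (Du≥0 x) (ℤP.≮⇒≥ (not-pos pos-Du-x)))

    three-edges : edgesBetween G Du Dv ≡ 3
    three-edges = ℤP.+-injective (begin
      + edgesBetween G Du Dv ≡⟨ ∑ℕ≡sum (λ x → ∑ℕ (λ w → if pos (Du x) ∧ pos (Dv w) then adj x w else 0)) ⟩
      sum (λ x → + ∑ℕ (λ w → if pos (Du x) ∧ pos (Dv w) then adj x w else 0)) ≡⟨ sum-cong-≗ row ⟩
      sum Du                 ≡⟨ degree-3 {Du} Du∼D ⟩
      + 3                    ∎)
      where open ≡-Reasoning

    edges-from-u' : (u' : Vertex G) → InSupp G u' Du →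
       (Du' : Divisor G) → Effective G Du' → Equiv G Du' D → InSupp G u' Du' →
       + edgesTo G u' Dv ≡ Du' u'
    edges-from-u' u' 0<Du-u' Du' Du'≥0 Du'∼D 0<Du'-u' =
      trans (edgesTo-Dv (Up.supp-E⊆T 0<Du-u')) (unique {Du} {Du'} Du≥0 Du'≥0 Du∼D Du'∼D 0<Du-u' 0<Du'-u' u')

-- The theorem: the rank hypothesis excludes the single-edge graph, so every separating cut has at
-- least 3 edges, and Lemma 3.4 follows from adjacent-classes.
lemma3p4 : (G : Graph) → Simple G → Connected G → ThreeEdgeConnected G →
    Gonality G 3 →
    (D : Divisor G) → HasRank G D (+ 1) → deg G D ≡ + 3 →
    (u v : Vertex G) → 1 ℕ.≤ Graph.adj G u v →
    (Du : Divisor G) → Effective G Du → Equiv G Du D → InSupp G u Du →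
    (Dv : Divisor G) → Effective G Dv → Equiv G Dv D → InSupp G v Dv →
    ¬ SameSupp G Du Dv →
    (edgesBetween G Du Dv ≡ 3)
    × ((u' : Vertex G) → InSupp G u' Du →
       (Du' : Divisor G) → Effective G Du' → Equiv G Du' D → InSupp G u' Du' →
       + edgesTo G u' Dv ≡ Du' u')
lemma3p4 G _ conn tec _ D rank≡1 degD = adjacent-classes
  where
  not-single-edge : ¬ SingleEdge G
  not-single-edge = rank-one-not-single-edge G D rank≡1 degD
  open EffectiveRepresentatives G (cut≥3 G conn tec not-single-edge) D degD
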